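{- Let $n$ be a natural number and $R$ a finite list of comparator networks that is size complete for $n$ channels and such that no element of $R$ is a sorting network on $n$ channels. Then $\mathrm{OGenerate}(R,n)$ is size complete for $n$ channels.
   Context: A comparator is a pair $(i,j)$ of natural numbers; a comparator network is a finite list of comparators, and its size is the number of comparators. $C_1;C_2$ denotes concatenation. A network $C$ is a network on $n$ channels if every comparator $(i,j)$ in it has $i<n$, $j<n$, $i\neq j$; it is standard on $n$ channels if every comparator $(i,j)$ in it has $i<j<n$. For $\vec x=(x_0,\ldots,x_{n-1})\in\{0,1\}^n$, applying comparator $(i,j)$ leaves $\vec x$ unchanged if $x_i\le x_j$ and otherwise swaps the entries at positions $i$ and $j$; $C(\vec x)$ is the result of applying the comparators of $C$ in order. $C$ is a sorting network on $n$ channels if it is a network on $n$ channels and $C(\vec x)$ is nondecreasing for all $\vec x\in\{0,1\}^n$. A comparator $c=(i,j)$ is redundant after $C_1$ (on $n$ channels) if $C_1(\vec x)_i\le C_1(\vec x)_j$ for every $\vec x\in\{0,1\}^n$. A network $D$ has no redundant comparators if whenever $D=C_1;c;C_2$, $c$ is not redundant after $C_1$. A list $R$ of comparator networks is size complete for $n$ channels if for every $k$: whenever there exists a sorting network on $n$ channels of size $k$, there exist $C'\in R$ and a network $C''$ such that $C';C''$ is standard on $n$ channels, has no redundant comparators, is a sorting network on $n$ channels, and has size at most $k$. $\mathrm{Generate}(R,n)$ is the list of all networks $C;(i,j)$ with $C\in R$ and $(i,j)$ any standard comparator on $n$ channels (i.e., $i<j<n$). $\mathrm{OGenerate}(R,n)$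 is obtained from $\mathrm{Generate}(R,n)$ by removing every network of the form $C';c$ in which $c$ is redundant after $C'$. -}

module Defs where

open import Data.Nat using (ℕ; zero; suc; _<_; _≤_)
open import Data.Bool using (Bool; true; false; if_then_else_; _∧_; not)
open import Data.Maybe using (Maybe; just; nothing)
open import Data.Vec using (Vec; []; _∷_)
open import Data.List using (List; []; _∷_; _++_; length; concatMap; filterᵇ; map; upTo)
open import Data.List.Relation.Unary.All using (All)
open import Data.List.Membership.Propositional using (_∈_)
open import Data.Product using (_×_; _,_; ∃-syntax; proj₁; proj₂)
open import Relation.Binary.PropositionalEquality using (_≡_)
open import Relation.Nullary using (¬_)
open import Data.Fin using (Fin; toℕ)

Comparator : Set
Comparator = ℕ × ℕ

Network : Set
Network = List Comparator

size : Network → ℕ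
size = length

-- Order on bits (false = 0, true = 1).
data _≤B_ : Bool → Bool → Set where
  f≤b : ∀ {b} → false ≤B b
  t≤t : true ≤B true

IsNetworkOn : ℕ → Network → Set
IsNetworkOn n C = All (λ c → (proj₁ c < n) × (proj₂ c < n) × ¬ (proj₁ c ≡ proj₂ c)) C

IsStandardOn : ℕ → Network → Set
IsStandardOn n C = All (λ c → (proj₁ c < proj₂ c) × (proj₂ c < n)) C

get : ∀ {n} → Vec Bool n → ℕ → Maybe Bool
get []       _       = nothing
get (b ∷ bs) zero    = just b
get (b ∷ bs) (suc m) = get bs m

set : ∀ {n} → Vec Bool n → ℕ → Bool → Vec Bool n
set []       _       _ = []
set (b ∷ bs) zero    v = v ∷ bs
set (b ∷ bs) (suc m) v = b ∷ set bs m v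

-- Applying comparator (i,j): leave x unchanged if x_i ≤ x_j, otherwise swap
-- positions i and j. (Out-of-range comparators, which never occur in networks
-- on n channels, act as the identity.)
applyComp : ∀ {n} → Comparator → Vec Bool n → Vec Bool n
applyComp (i , j) x with get x i | get x j
... | just xi | just xj = if xi ∧ not xj then set (set x i xj) j xi else x
... | _       | _       = x

run : ∀ {n} → Network → Vec Bool n → Vec Bool n
run []      x = x
run (c ∷ C) x = run C (applyComp c x)

data Sorted : ∀ {n} → Vec Bool n → Set where
  s[]  : Sorted []
  s[_] : ∀ b → Sorted (b ∷ [])
  s∷   : ∀ {n a b} {xs : Vec Bool n} → a ≤B b → Sorted (b ∷ xs) → Sorted (a ∷ b ∷ xs)

IsSortingNetwork : ℕ → Network → Set
IsSortingNetwork n C = IsNetworkOn n C × ((x : Vec Bool n) → Sorted (run C x))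

Redundant : ℕ → Network → Comparator → Set
Redundant n C₁ (i , j) =
  (x : Vec Bool n) (a b : Bool) →
  get (run C₁ x) i ≡ just a → get (run C₁ x) j ≡ just b → a ≤B b

NoRedundant : ℕ → Network → Set
NoRedundant n D =
  (C₁ C₂ : Network) (c : Comparator) → D ≡ C₁ ++ (c ∷ C₂) → ¬ Redundant n C₁ c

SizeComplete : ℕ → List Network → Set
SizeComplete n R =
  (k : ℕ) →
  (∃[ C ] (IsSortingNetwork n C × size C ≡ k)) →
  ∃[ C' ] ∃[ C'' ] (C' ∈ R
                    × IsStandardOn n (C' ++ C'')
                    × NoRedundant n (C' ++ C'')
                    × IsSortingNetwork n (C' ++ C'')
                    × size (C' ++ C'') ≤ k)

standardComps : ℕ → List Comparator
standardComps n = concatMap (λ j → map (λ i → (i , j)) (upTo j)) (upTo n)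

Generate : List Network → ℕ → List Network
Generate R n = concatMap (λ C → map (λ c → C ++ (c ∷ [])) (standardComps n)) R

allVecs : (n : ℕ) → List (Vec Bool n)
allVecs zero    = [] ∷ᴸ []
  where open Data.List using () renaming (_∷_ to _∷ᴸ_)
allVecs (suc n) = map (false ∷_) (allVecs n) ++ map (true ∷_) (allVecs n)

-- Boolean bit order and out-of-range convention matching Redundant.
leqMaybe : Maybe Bool → Maybe Bool → Bool
leqMaybe (just true) (just false) = false
leqMaybe _           _            = true

allᵇ : {A : Set} → (A → Bool) → List A → Bool
allᵇ p []       = true
allᵇ p (x ∷ xs) = p x ∧ allᵇ p xs

redundantᵇ : ℕ → Network → Comparator → Bool
redundantᵇ n C₁ (i , j) =
  allᵇ (λ x → leqMaybe (get (run C₁ x) i) (get (run C₁ x) j)) (allVecs n)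

lastSplit : Network → Maybe (Network × Comparator)
lastSplit []      = nothing
lastSplit (c ∷ C) with lastSplit C
... | nothing        = just ([] , c)
... | just (C' , d)  = just (c ∷ C' , d)

keep : ℕ → Network → Bool
keep n D with lastSplit D
... | nothing       = true
... | just (C' , c) = not (redundantᵇ n C' c)

OGenerate : List Network → ℕ → List Network
OGenerate R n = filterᵇ (keep n) (Generate R n)

-- Take a completion C' ; C'' witnessing size completeness of R. As C' is not
-- itself sorting, C'' has a first comparator c, which is standard and (since
-- C' ; C'' has no redundant comparators) not redundant after C'. Hence C' ; c
-- survives in OGenerate(R,n), and C' ; c followed by the rest of C'' is the
-- very same network.
module Submission where

open import Defs
open import Data.Nat using (ℕ; suc; _<_; _≤_)
open import Data.Bool using (Bool; true; false; T)
open import Data.Bool.Properties using (T?; ∧-conicalˡ; ∧-conicalʳ)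
open import Data.Maybe using (just)
open import Data.Vec using (Vec; []; _∷_)
open import Data.List using (List; []; _∷_; _++_; map; upTo)
open import Data.List.Properties using (++-assoc; ++-identityʳ)
open import Data.List.Relation.Unary.Any using (here; there)
import Data.List.Relation.Unary.Any as Any
open import Data.List.Relation.Unary.All using (All)
import Data.List.Relation.Unary.All as All
open import Data.List.Relation.Unary.All.Properties using (++⁻ʳ)
open import Data.List.Membership.Propositional using (_∈_)
open import Data.List.Membership.Propositional.Properties
  using (∈-map⁺; ∈-++⁺ˡ; ∈-++⁺ʳ; ∈-concatMap⁺; ∈-upTo⁺; ∈-filter⁺)
open import Data.Product using (_×_; _,_; proj₁; proj₂)
open import Data.Empty using (⊥-elim)
open import Function using (_∘_)
open import Relation.Binary.PropositionalEquality using (_≡_; refl; sym; subst; subst₂)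
open import Relation.Nullary using (¬_)

lastSplit-snoc : ∀ C c → lastSplit (C ++ c ∷ []) ≡ just (C , c)
lastSplit-snoc []      c = refl
lastSplit-snoc (d ∷ C) c rewrite lastSplit-snoc C c = refl

∈-allVecs : ∀ {n} (x : Vec Bool n) → x ∈ allVecs n
∈-allVecs []                = here refl
∈-allVecs {suc n} (false ∷ x) = ∈-++⁺ˡ (∈-map⁺ (false ∷_) (∈-allVecs x))
∈-allVecs {suc n} (true ∷ x)  =
  ∈-++⁺ʳ (map (false ∷_) (allVecs n)) (∈-map⁺ (true ∷_) (∈-allVecs x))

allᵇ-sound : {A : Set} (p : A → Bool) {xs : List A} →
             allᵇ p xs ≡ true → ∀ {x} → x ∈ xs → p x ≡ true
allᵇ-sound p {y ∷ _} holds (here refl) = ∧-conicalˡ (p y) _ holds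
allᵇ-sound p {y ∷ _} holds (there x∈) = allᵇ-sound p (∧-conicalʳ (p y) _ holds) x∈

leqMaybe-sound : ∀ {a b} → leqMaybe (just a) (just b) ≡ true → a ≤B b
leqMaybe-sound {false}         _ = f≤b
leqMaybe-sound {true} {true}   _ = t≤t
leqMaybe-sound {true} {false} ()

redundantᵇ-sound : ∀ n C c → redundantᵇ n C c ≡ true → Redundant n C c
redundantᵇ-sound n C (i , j) holds x a b xᵢ≡a xⱼ≡b =
  leqMaybe-sound (subst₂ (λ u v → leqMaybe u v ≡ true) xᵢ≡a xⱼ≡b
    (allᵇ-sound (λ y → leqMaybe (get (run C y) i) (get (run C y) j)) holds (∈-allVecs x)))

keep-snoc : ∀ n C c → ¬ Redundant n C c → T (keep n (C ++ c ∷ []))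
keep-snoc n C c irredundant with lastSplit (C ++ c ∷ []) | lastSplit-snoc C c
... | _ | refl with redundantᵇ n C c in holds
...   | true  = ⊥-elim (irredundant (redundantᵇ-sound n C c holds))
...   | false = _

∈-standardComps : ∀ {n i j} → i < j → j < n → (i , j) ∈ standardComps n
∈-standardComps {j = j} i<j j<n =
  ∈-concatMap⁺ (λ j′ → map (λ i′ → (i′ , j′)) (upTo j′))
    (Any.map (λ { refl → ∈-map⁺ (λ i′ → (i′ , j)) (∈-upTo⁺ i<j) }) (∈-upTo⁺ j<n))

∈-Generate : ∀ {R} n {C c} → C ∈ R → c ∈ standardComps n → C ++ c ∷ [] ∈ Generate R n
∈-Generate n {C} C∈R c∈ =
  ∈-concatMap⁺ (λ D → map (λ d → D ++ d ∷ []) (standardComps n))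
    (Any.map (λ { refl → ∈-map⁺ (λ d → C ++ d ∷ []) c∈ }) C∈R)

∈-OGenerate : ∀ {R n C i j} → C ∈ R → i < j → j < n → ¬ Redundant n C (i , j) →
              C ++ (i , j) ∷ [] ∈ OGenerate R n
∈-OGenerate {n = n} {C} {i} {j} C∈R i<j j<n irredundant =
  ∈-filter⁺ (T? ∘ keep n) (∈-Generate n C∈R (∈-standardComps i<j j<n))
    (keep-snoc n C (i , j) irredundant)

GoodSortingNetwork : ℕ → ℕ → Network → Set
GoodSortingNetwork n k D =
  IsStandardOn n D × NoRedundant n D × IsSortingNetwork n D × size D ≤ k

mainTheorem4 : (n : ℕ) (R : List Network) →
    SizeComplete n R →
    All (λ C → ¬ IsSortingNetwork n C) R →
    SizeComplete n (OGenerate R n)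
mainTheorem4 n R complete unsorting k sortable with complete k sortable
... | C′ , [] , C′∈R , (_ , _ , sorts , _) =
  ⊥-elim (All.lookup unsorting C′∈R (subst (IsSortingNetwork n) (++-identityʳ C′) sorts))
... | C′ , (i , j) ∷ C″ , C′∈R , good@(standard , irredundant , _ , _) =
  C′ ++ (i , j) ∷ [] , C″ ,
  ∈-OGenerate C′∈R i<j j<n (irredundant C′ C″ (i , j) refl) ,
  subst (GoodSortingNetwork n k) (sym (++-assoc C′ ((i , j) ∷ []) C″)) good
  where
  i<j : i < j
  i<j = proj₁ (All.head (++⁻ʳ C′ standard))
  j<n : j < n
  j<n = proj₂ (All.head (++⁻ʳ C′ standard))
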